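{- Let $P_n$ be the path graph on $n\ge 2$ vertices. Then $$A(P_n;x)=(n-2)x^{n-2}+2x^{n-1}+\frac{(n-2)(n+1)}{2}x^n+x^{n+1}.$$
   Context: For a finite simple graph $\Gamma=(V,E)$ of order $n$, a vertex $v$ and $X\subseteq V$, $\delta_X(v)$ is the number of neighbours of $v$ in $X$, $\delta_1$ the maximum degree, $\bar S=V\setminus S$, and $\mathcal{K}=[-\delta_1,\delta_1]\cap\mathbb{Z}$. A nonempty $S\subseteq V$ is a defensive $k$-alliance if $\delta_S(v)\ge\delta_{\bar S}(v)+k$ for all $v\in S$; its exact index of alliance is $k_S=\max\{k\in\mathcal{K}: S \text{ is a defensive } k\text{ -alliance}\}$. The alliance polynomial is $A(\Gamma;x)=\sum_{S} x^{n+k_S}$, the sum over all nonempty $S\subseteq V$ with induced subgraph $\langle S\rangle$ connected. -}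

module Defs where

open import Data.Bool using (Bool; true; false; _∧_; _∨_; not; if_then_else_)
open import Data.Nat as ℕ using (ℕ; zero; suc; _≡ᵇ_)
import Data.Nat.Properties as ℕP
open import Data.Integer as ℤ using (ℤ; +_; -_; _-_; _≤ᵇ_)
open import Data.Fin using (Fin; toℕ)
open import Data.Fin.Subset using (Subset; _∈_; ⁅_⁆; _∪_; ∁)
open import Data.Vec using (Vec; []; _∷_; lookup; tabulate)
open import Data.List as List using (List; []; _∷_; _++_; filter; length; allFin; upTo)
open import Data.Bool.ListAction using (any; all)
open import Relation.Binary.PropositionalEquality using (_≡_; refl)
open import Relation.Nullary.Decidable using (does)
open import Relation.Nullary using (Dec; yes; no)

record Graph (n : ℕ) : Set where
  field
    adj    : Fin n → Fin n → Bool
    sym    : ∀ u v → adj u v ≡ adj v u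
    irrefl : ∀ v → adj v v ≡ false
open Graph public

pathAdj : ∀ {n} → Fin n → Fin n → Bool
pathAdj u v = (suc (toℕ u) ≡ᵇ toℕ v) ∨ (suc (toℕ v) ≡ᵇ toℕ u)

private
  ∨-comm : ∀ a b → (a ∨ b) ≡ (b ∨ a)
  ∨-comm false false = refl
  ∨-comm false true  = refl
  ∨-comm true  false = refl
  ∨-comm true  true  = refl

  suc≢ : ∀ m → (suc m ≡ᵇ m) ≡ false
  suc≢ zero    = refl
  suc≢ (suc m) = suc≢ m

  pathIrrefl : ∀ {n} (v : Fin n) → pathAdj v v ≡ false
  pathIrrefl v with suc (toℕ v) ≡ᵇ toℕ v | suc≢ (toℕ v)
  ... | false | _ = refl

PathGraph : (n : ℕ) → Graph n
PathGraph n = record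
  { adj    = pathAdj
  ; sym    = λ u v → ∨-comm (suc (toℕ u) ≡ᵇ toℕ v) (suc (toℕ v) ≡ᵇ toℕ u)
  ; irrefl = pathIrrefl
  }


countᵇ : ∀ {A : Set} → (A → Bool) → List A → ℕ
countᵇ p []       = 0
countᵇ p (x ∷ xs) = (if p x then 1 else 0) ℕ.+ countᵇ p xs

filterᵇ : ∀ {A : Set} → (A → Bool) → List A → List A
filterᵇ p []       = []
filterᵇ p (x ∷ xs) = if p x then x ∷ filterᵇ p xs else filterᵇ p xs

count : ∀ {n} → (Fin n → Bool) → ℕ
count p = countᵇ p (allFin _)

δ : ∀ {n} → Graph n → Subset n → Fin n → ℕ
δ G X v = count (λ u → adj G v u ∧ lookup X u)

deg : ∀ {n} → Graph n → Fin n → ℕ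
deg G v = count (λ u → adj G v u)

δ₁ : ∀ {n} → Graph n → ℕ
δ₁ G = List.foldr ℕ._⊔_ 0 (List.map (deg G) (allFin _))

subsets : (n : ℕ) → List (Subset n)
subsets zero    = [] ∷ []
subsets (suc n) = List.map (true ∷_) (subsets n) ++ List.map (false ∷_) (subsets n)

nonempty : ∀ {n} → Subset n → Bool
nonempty S = any (lookup S) (allFin _)

allIn : ∀ {n} → Subset n → (Fin n → Bool) → Bool
allIn S p = all (λ v → not (lookup S v) ∨ p v) (allFin _)

-- Connectedness of the induced subgraph ⟨S⟩.
-- reach G S R t : vertices of S joined inside ⟨S⟩ to some vertex of R
-- by a walk of length ≤ t (for R ⊆ S).

step : ∀ {n} → Graph n → Subset n → Subset n → Subset n
step G S R = tabulate (λ v → lookup R v ∨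
               (lookup S v ∧ any (λ u → lookup R u ∧ adj G u v) (allFin _)))

reach : ∀ {n} → Graph n → Subset n → Subset n → ℕ → Subset n
reach G S R zero    = R
reach G S R (suc t) = step G S (reach G S R t)

connected : ∀ {n} → Graph n → Subset n → Bool
connected {n} G S =
  nonempty S ∧ allIn S (λ u → allIn S (λ v → lookup (reach G S ⁅ u ⁆ n) v))

isDefAlliance : ∀ {n} → Graph n → Subset n → ℤ → Bool
isDefAlliance G S k =
  allIn S (λ v → (ℤ._+_ (+ δ G (∁ S) v) k) ≤ᵇ (+ δ G S v))

𝒦 : ∀ {n} → Graph n → List ℤ
𝒦 G = List.map (λ i → ℤ._+_ (- (+ δ₁ G)) (+ i)) (upTo (suc (2 ℕ.* δ₁ G)))

-- k_S = max{k ∈ 𝒦 : S is a defensive k-alliance}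
-- (the maximum of the members of 𝒦 with the property; -δ₁ is ≤ all of 𝒦,
--  and the set is always nonempty for nonempty S)
exactIndex : ∀ {n} → Graph n → Subset n → ℤ
exactIndex G S =
  List.foldr ℤ._⊔_ (- (+ δ₁ G)) (filterᵇ (isDefAlliance G S) (𝒦 G))

-- Polynomials with ℕ coefficients, represented by their coefficient
-- function on (integer) exponents; equality of polynomials is
-- pointwise equality of coefficients.

Poly : Set
Poly = ℤ → ℕ

monomial : ℕ → ℤ → Poly
monomial c e j with ℤ._≟_ j e
... | yes _ = c
... | no  _ = 0

_⊕_ : Poly → Poly → Poly
(p ⊕ q) j = p j ℕ.+ q j
infixl 6 _⊕_

A : ∀ {n} → Graph n → Poly
A {n} G j = countᵇ (λ S → connected G S ∧ does (ℤ._≟_ (ℤ._+_ (+ n) (exactIndex G S)) j))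
             (subsets n)

module Submission where

-- The nonempty vertex sets of P_n inducing connected subgraphs are exactly the
-- intervals [a,b] of positions.  For an interval the least margin δ_S(v) − δ_S̄(v) over
-- v ∈ S, which is its exact index k_S, depends only on its shape: +1 for the whole path,
-- −1 for a single end vertex, −2 for a single interior vertex and 0 for every other
-- interval.  Hence A(P_n) counts intervals by shape.
--
-- A subset is a Boolean vector, and `subsets (suc n)` is built by prefixing a
-- bit to every subset of size n.  We therefore read a subset from its last position
-- towards position 0 with an eleven-state automaton (`Shape`) that records the shape of
-- the part read so far; the number of subsets of size n in each state obeys a linear
-- recurrence (`census`), solved in closed form for n = m + 2.  Independently we show that
-- each final state describes the set faithfully (`form`): empty, having a gap, or an
-- interval of a given kind.

open import Data.Bool using (Bool; true; false; _∧_; _∨_; not; if_then_else_; T)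
open import Data.Bool.Properties using (∧-identityʳ; ∧-zeroʳ; ∧-inverseʳ; ∨-zeroʳ; T-≡; ⇔→≡)
open import Data.Bool.ListAction using (any; all)
open import Data.Empty using (⊥-elim)
open import Data.Fin using (Fin; toℕ; fromℕ<) renaming (zero to fzero; suc to fsuc)
open import Data.Fin.Properties using (toℕ<n; toℕ-injective; toℕ-fromℕ<)
open import Data.Fin.Subset using (Subset; ∁; ⁅_⁆)
open import Data.Fin.Subset.Properties using (x∈⁅x⁆; x∈⁅y⁆⇒x≡y)
open import Data.Integer as ℤ using (ℤ; +_; -[1+_])
import Data.Integer.Properties as ℤP
open import Data.List as List using (List; []; _∷_; _++_)
open import Data.List.Membership.Propositional using (lose)
open import Data.List.Membership.Propositional.Properties using (∈-allFin)
open import Data.List.Relation.Unary.All as All using ()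
open import Data.List.Relation.Unary.All.Properties using (all⁺; all⁻)
open import Data.List.Relation.Unary.Any as Any using ()
open import Data.List.Relation.Unary.Any.Properties using (any⁺; any⁻)
open import Data.Nat as ℕ
  using (ℕ; zero; suc; _+_; _*_; _∸_; _/_; _≥_; _≤_; _<_; z≤n; s≤s; _≡ᵇ_; _⊔_)
open import Data.Nat.DivMod using (m*n/n≡m)
open import Data.Nat.Properties
  using ( ≤-refl; ≤-reflexive; ≤-trans; ≤-antisym; ≤-total; <-trans; <-≤-trans; ≤-<-trans
        ; <⇒≤; ≤∧≢⇒<; ≮⇒≥; n≤1+n; n<1+n; m≤n⇒m≤1+n; m≤m+n; m≤n+m; +-mono-≤
        ; ⊔-lub; m≤m⊔n; m≤n⊔m; +-assoc; +-comm; +-suc; +-identityʳ; *-identityʳ; *-zeroʳ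
        ; m∸n≤m; m+[n∸m]≡n; m∸n+n≡m; ≡ᵇ⇒≡; ≡⇒≡ᵇ )
open import Data.Nat.Tactic.RingSolver using (solve-∀)
open import Data.Product using (Σ; _×_; _,_; proj₁; proj₂)
open import Data.Sum using (_⊎_; inj₁; inj₂)
open import Data.Vec using (Vec; []; _∷_; lookup)
open import Data.Vec.Properties using (lookup∘tabulate; []=⇒lookup; lookup⇒[]=)
open import Function using (_∘_)
open import Function.Bundles using (Equivalence; mk⇔)
open import Relation.Binary.PropositionalEquality
open import Relation.Nullary using (yes; no; does)
open import Defs hiding (sym)

𝟙 : Bool → ℕ
𝟙 b = if b then 1 else 0

𝟙≤1 : ∀ b → 𝟙 b ≤ 1
𝟙≤1 true  = ≤-refl
𝟙≤1 false = z≤n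

count-++ : ∀ {X : Set} (p : X → Bool) xs ys →
  countᵇ p (xs ++ ys) ≡ countᵇ p xs + countᵇ p ys
count-++ p []       ys = refl
count-++ p (x ∷ xs) ys =
  trans (cong (_+_ (𝟙 (p x))) (count-++ p xs ys)) (sym (+-assoc (𝟙 (p x)) _ _))

count-map : ∀ {X Y : Set} (p : Y → Bool) (f : X → Y) xs →
  countᵇ p (List.map f xs) ≡ countᵇ (p ∘ f) xs
count-map p f []       = refl
count-map p f (x ∷ xs) = cong (_+_ (𝟙 (p (f x)))) (count-map p f xs)

count-cong : ∀ {X : Set} {p q : X → Bool} → (∀ x → p x ≡ q x) → ∀ xs →
  countᵇ p xs ≡ countᵇ q xs
count-cong e []       = refl
count-cong e (x ∷ xs) = cong₂ (λ b k → 𝟙 b + k) (e x) (count-cong e xs)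

-- Reading a subset from its last position towards position 0, the automaton keeps the
-- shape of the part read so far, i.e. of the suffix, viewed as a subset of the path on
-- the positions read (whose left end is the current position).  A state is named after
-- what the suffix is: nothing read (`start`), only absent positions (`zeros`), the whole
-- suffix (`whole₁` of one vertex, `whole` of more), an interval touching only the left
-- end (`left₁`, `left`), only the right end (`right₁`, `right`), neither end (`inner₁`,
-- `inner`), or not an interval (`split`).  The index ₁ marks single vertices.
data Shape : Set where
  start zeros whole₁ whole left₁ left right₁ right inner₁ inner split : Shape

push : Bool → Shape → Shape
push true  start  = whole₁
push true  zeros  = left₁
push true  whole₁ = whole
push true  whole  = whole
push true  left₁  = left
push true  left   = left
push true  _      = split
push false start  = zeros
push false zeros  = zeros
push false whole₁ = right₁
push false whole  = right
push false left₁  = inner₁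
push false left   = inner
push false c      = c

shapeOf : ∀ {n} → Vec Bool n → Shape
shapeOf []      = start
shapeOf (b ∷ S) = push b (shapeOf S)

-- census n c is the number of subsets of size n in state c, defined by the recurrence
-- obtained from the predecessors of each state under push.
census : ℕ → Shape → ℕ
census zero    start  = 1
census zero    _      = 0
census (suc n) start  = 0
census (suc n) zeros  = census n start + census n zeros
census (suc n) whole₁ = census n start
census (suc n) whole  = census n whole₁ + census n whole
census (suc n) left₁  = census n zeros
census (suc n) left   = census n left₁ + census n left
census (suc n) right₁ = census n whole₁ + census n right₁
census (suc n) right  = census n whole + census n right
census (suc n) inner₁ = census n left₁ + census n inner₁
census (suc n) inner  = census n left + census n inner
census (suc n) split  = census n right₁ + census n right + census n inner₁ + census n inner
                          + (census n split + census n split)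

weigh : (Shape → ℕ) → (Shape → Bool) → ℕ
weigh f h =
  𝟙 (h start) * f start + 𝟙 (h zeros) * f zeros + 𝟙 (h whole₁) * f whole₁
  + 𝟙 (h whole) * f whole + 𝟙 (h left₁) * f left₁ + 𝟙 (h left) * f left
  + 𝟙 (h right₁) * f right₁ + 𝟙 (h right) * f right + 𝟙 (h inner₁) * f inner₁
  + 𝟙 (h inner) * f inner + 𝟙 (h split) * f split

weigh-cong : ∀ {f g : Shape → ℕ} → (∀ c → f c ≡ g c) → ∀ h → weigh f h ≡ weigh g h
weigh-cong e h rewrite e start | e zeros | e whole₁ | e whole | e left₁ | e left
                     | e right₁ | e right | e inner₁ | e inner | e split = refl

-- In the inductive step the subsets with a first
-- bit b are counted by the states they had before reading b; regrouping this sum by the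
-- state after reading b is the recurrence defining census.
count-by-shape : ∀ n (h : Shape → Bool) →
  countᵇ (h ∘ shapeOf) (subsets n) ≡ weigh (census n) h
count-by-shape zero h =
  initial (𝟙 (h start)) (𝟙 (h zeros)) (𝟙 (h whole₁)) (𝟙 (h whole)) (𝟙 (h left₁))
          (𝟙 (h left)) (𝟙 (h right₁)) (𝟙 (h right)) (𝟙 (h inner₁)) (𝟙 (h inner)) (𝟙 (h split))
  where
  initial : ∀ e z w₁ w l₁ l r₁ r i₁ i s →
    e + 0 ≡ e * 1 + z * 0 + w₁ * 0 + w * 0 + l₁ * 0 + l * 0
              + r₁ * 0 + r * 0 + i₁ * 0 + i * 0 + s * 0
  initial = solve-∀
count-by-shape (suc n) h = begin
    countᵇ (h ∘ shapeOf) (with-bit true ++ with-bit false)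
  ≡⟨ count-++ (h ∘ shapeOf) (with-bit true) (with-bit false) ⟩
    countᵇ (h ∘ shapeOf) (with-bit true) + countᵇ (h ∘ shapeOf) (with-bit false)
  ≡⟨ cong₂ _+_ (count-map (h ∘ shapeOf) (true ∷_) (subsets n))
               (count-map (h ∘ shapeOf) (false ∷_) (subsets n)) ⟩
    countᵇ (h ∘ push true ∘ shapeOf) (subsets n) + countᵇ (h ∘ push false ∘ shapeOf) (subsets n)
  ≡⟨ cong₂ _+_ (count-by-shape n (h ∘ push true)) (count-by-shape n (h ∘ push false)) ⟩
    weigh (census n) (h ∘ push true) + weigh (census n) (h ∘ push false)
  ≡⟨ regroup (𝟙 (h start)) (𝟙 (h zeros)) (𝟙 (h whole₁)) (𝟙 (h whole)) (𝟙 (h left₁))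
       (𝟙 (h left)) (𝟙 (h right₁)) (𝟙 (h right)) (𝟙 (h inner₁)) (𝟙 (h inner)) (𝟙 (h split))
       (N start) (N zeros) (N whole₁) (N whole) (N left₁) (N left) (N right₁) (N right)
       (N inner₁) (N inner) (N split) ⟩
    weigh (census (suc n)) h
  ∎
  where
  open ≡-Reasoning
  with-bit : Bool → List (Subset (suc n))
  with-bit b = List.map (b ∷_) (subsets n)
  N = census n
  regroup : ∀ e z w₁ w l₁ l r₁ r i₁ i s Ne Nz Nw₁ Nw Nl₁ Nl Nr₁ Nr Ni₁ Ni Ns →
    (w₁ * Ne + l₁ * Nz + w * Nw₁ + w * Nw + l * Nl₁ + l * Nl
       + s * Nr₁ + s * Nr + s * Ni₁ + s * Ni + s * Ns)
    + (z * Ne + z * Nz + r₁ * Nw₁ + r * Nw + i₁ * Nl₁ + i * Nl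
       + r₁ * Nr₁ + r * Nr + i₁ * Ni₁ + i * Ni + s * Ns)
    ≡ e * 0 + z * (Ne + Nz) + w₁ * Ne + w * (Nw₁ + Nw) + l₁ * Nz + l * (Nl₁ + Nl)
      + r₁ * (Nw₁ + Nr₁) + r * (Nw + Nr) + i₁ * (Nl₁ + Ni₁) + i * (Nl + Ni)
      + s * (Nr₁ + Nr + Ni₁ + Ni + (Ns + Ns))
  regroup = solve-∀

-- triangle m = m(m−1)/2, the number of intervals of length ≥ 2 inside m positions.
triangle : ℕ → ℕ
triangle zero    = 0
triangle (suc m) = m + triangle m

-- The census of subsets of size m + 2 in closed form.
census₂ : ℕ → Shape → ℕ
census₂ m start  = 0
census₂ m zeros  = 1
census₂ m whole₁ = 0
census₂ m whole  = 1
census₂ m left₁  = 1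
census₂ m left   = m
census₂ m right₁ = 1
census₂ m right  = m
census₂ m inner₁ = m
census₂ m inner  = triangle m
census₂ m split  = census (2 + m) split

census-closed : ∀ m c → census (2 + m) c ≡ census₂ m c
census-closed zero    start  = refl
census-closed zero    zeros  = refl
census-closed zero    whole₁ = refl
census-closed zero    whole  = refl
census-closed zero    left₁  = refl
census-closed zero    left   = refl
census-closed zero    right₁ = refl
census-closed zero    right  = refl
census-closed zero    inner₁ = refl
census-closed zero    inner  = refl
census-closed zero    split  = refl
census-closed (suc m) start  = refl
census-closed (suc m) zeros  = census-closed m zeros
census-closed (suc m) whole₁ = refl
census-closed (suc m) whole  = census-closed m whole
census-closed (suc m) left₁  = census-closed m zeros
census-closed (suc m) left   = cong₂ _+_ (census-closed m left₁) (census-closed m left)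
census-closed (suc m) right₁ = census-closed m right₁
census-closed (suc m) right  = cong₂ _+_ (census-closed m whole) (census-closed m right)
census-closed (suc m) inner₁ = cong₂ _+_ (census-closed m left₁) (census-closed m inner₁)
census-closed (suc m) inner  = cong₂ _+_ (census-closed m left) (census-closed m inner)
census-closed (suc m) split  = refl

-- Membership by numeric position, false beyond the end.  Positions are the vertices of
-- the path, so intervals and adjacency are arithmetic on ℕ.
infixl 9 _‼_
_‼_ : ∀ {n} → Vec Bool n → ℕ → Bool
[]      ‼ i     = false
(b ∷ S) ‼ zero  = b
(b ∷ S) ‼ suc i = S ‼ i

lookup-‼ : ∀ {n} (S : Subset n) (v : Fin n) → lookup S v ≡ S ‼ toℕ v
lookup-‼ (b ∷ S) fzero    = refl
lookup-‼ (b ∷ S) (fsuc v) = lookup-‼ S v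

‼-cons : ∀ {n b} {S : Subset n} {P : ℕ → Bool} →
  b ≡ P 0 → (∀ i → S ‼ i ≡ P (suc i)) → ∀ i → (b ∷ S) ‼ i ≡ P i
‼-cons head tail zero    = head
‼-cons head tail (suc i) = tail i

‼-beyond : ∀ {n} (S : Subset n) i → n ≤ i → S ‼ i ≡ false
‼-beyond []      i       _       = refl
‼-beyond (b ∷ S) (suc i) (s≤s p) = ‼-beyond S i p

‼-bound : ∀ {n} (S : Subset n) i → S ‼ i ≡ true → i < n
‼-bound (b ∷ S) zero    _ = s≤s z≤n
‼-bound (b ∷ S) (suc i) e = s≤s (‼-bound S i e)

‼-∁ : ∀ {n} (S : Subset n) i → i < n → ∁ S ‼ i ≡ not (S ‼ i)
‼-∁ (b ∷ S) zero    _       = refl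
‼-∁ (b ∷ S) (suc i) (s≤s p) = ‼-∁ S i p

-- Boolean comparisons on positions; defined structurally so that they compute on
-- partially known numbers such as 2 + k.
leq : ℕ → ℕ → Bool
leq zero    j       = true
leq (suc i) zero    = false
leq (suc i) (suc j) = leq i j

less : ℕ → ℕ → Bool
less i j = leq (suc i) j

within : ℕ → ℕ → ℕ → Bool
within a b i = leq a i ∧ leq i b

leq-true : ∀ {i j} → i ≤ j → leq i j ≡ true
leq-true z≤n     = refl
leq-true (s≤s p) = leq-true p

leq-false : ∀ {i j} → j < i → leq i j ≡ false
leq-false {suc i} {zero}  _       = refl
leq-false {suc i} {suc j} (s≤s p) = leq-false p

leq-sound : ∀ i j → leq i j ≡ true → i ≤ j
leq-sound zero    j       _ = z≤n
leq-sound (suc i) (suc j) e = s≤s (leq-sound i j e)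

less-irrefl : ∀ x → less x x ≡ false
less-irrefl x = leq-false {suc x} {x} ≤-refl

within-true : ∀ {a b i} → a ≤ i → i ≤ b → within a b i ≡ true
within-true p q rewrite leq-true p | leq-true q = refl

within-sound : ∀ a b i → within a b i ≡ true → a ≤ i × i ≤ b
within-sound a b i e with leq a i in a≤i
... | true = leq-sound a i a≤i , leq-sound i b e

IsInterval : ∀ {n} → Subset n → ℕ → ℕ → Set
IsInterval S a b = ∀ i → S ‼ i ≡ within a b i

interval-member : ∀ {n} {S : Subset n} {a b} → IsInterval S a b →
  ∀ v → a ≤ toℕ v → toℕ v ≤ b → lookup S v ≡ true
interval-member {S = S} I v p q = trans (lookup-‼ S v) (trans (I (toℕ v)) (within-true p q))

interval-bounds : ∀ {n} {S : Subset n} {a b} → IsInterval S a b →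
  ∀ v → lookup S v ≡ true → a ≤ toℕ v × toℕ v ≤ b
interval-bounds {S = S} {a} {b} I v e =
  within-sound a b (toℕ v) (trans (sym (I (toℕ v))) (trans (sym (lookup-‼ S v)) e))

data IntervalShape : ℕ → ℕ → ℕ → Shape → Set where
  is-whole₁ : IntervalShape 1 0 0 whole₁
  is-whole  : ∀ {b} → IntervalShape (2 + b) 0 (1 + b) whole
  is-left₁  : ∀ {n} → 1 < n → IntervalShape n 0 0 left₁
  is-left   : ∀ {n b} → 1 ≤ b → suc b < n → IntervalShape n 0 b left
  is-right₁ : ∀ {a} → IntervalShape (2 + a) (1 + a) (1 + a) right₁
  is-right  : ∀ {a b} → 1 ≤ a → a < b → IntervalShape (suc b) a b right
  is-inner₁ : ∀ {n a} → 1 ≤ a → suc a < n → IntervalShape n a a inner₁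
  is-inner  : ∀ {n a b} → 1 ≤ a → a < b → suc b < n → IntervalShape n a b inner

shape-bounds : ∀ {n a b c} → IntervalShape n a b c → a ≤ b × b < n
shape-bounds is-whole₁        = z≤n , ≤-refl
shape-bounds is-whole         = z≤n , ≤-refl
shape-bounds (is-left₁ p)     = z≤n , <-trans (s≤s z≤n) p
shape-bounds (is-left p q)    = z≤n , <-trans (n<1+n _) q
shape-bounds is-right₁        = ≤-refl , ≤-refl
shape-bounds (is-right p q)   = <⇒≤ q , ≤-refl
shape-bounds (is-inner₁ p q)  = ≤-refl , <-trans (n<1+n _) q
shape-bounds (is-inner p q r) = <⇒≤ q , <-trans (n<1+n _) r

shift-absent : ∀ {n a b c} → IntervalShape n a b c →
  IntervalShape (suc n) (suc a) (suc b) (push false c)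
shift-absent is-whole₁        = is-right₁
shift-absent is-whole         = is-right (s≤s z≤n) (s≤s (s≤s z≤n))
shift-absent (is-left₁ p)     = is-inner₁ (s≤s z≤n) (s≤s p)
shift-absent (is-left p q)    = is-inner (s≤s z≤n) (s≤s p) (s≤s q)
shift-absent is-right₁        = is-right₁
shift-absent (is-right p q)   = is-right (m≤n⇒m≤1+n p) (s≤s q)
shift-absent (is-inner₁ p q)  = is-inner₁ (m≤n⇒m≤1+n p) (s≤s q)
shift-absent (is-inner p q r) = is-inner (m≤n⇒m≤1+n p) (s≤s q) (s≤s r)

extend-left : ∀ {n b c} → IntervalShape n 0 b c →
  IntervalShape (suc n) 0 (suc b) (push true c)
extend-left is-whole₁         = is-whole
extend-left is-whole          = is-whole
extend-left (is-left₁ p)      = is-left (s≤s z≤n) (s≤s p)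
extend-left (is-left p q)     = is-left (m≤n⇒m≤1+n p) (s≤s q)
extend-left (is-right () q)
extend-left (is-inner₁ () q)
extend-left (is-inner () q r)

detached-split : ∀ {n a b c} → IntervalShape n (suc a) b c → push true c ≡ split
detached-split is-right₁        = refl
detached-split (is-right p q)   = refl
detached-split (is-inner₁ p q)  = refl
detached-split (is-inner p q r) = refl

data Form {n : ℕ} (S : Subset n) : Set where
  empty    : (∀ i → S ‼ i ≡ false) →
             (shapeOf S ≡ start × n ≡ 0) ⊎ (shapeOf S ≡ zeros × 1 ≤ n) → Form S
  gap      : ∀ i j k → i < j → j < k → S ‼ i ≡ true → S ‼ j ≡ false → S ‼ k ≡ true →
             shapeOf S ≡ split → Form S
  interval : ∀ a b → IsInterval S a b → IntervalShape n a b (shapeOf S) → Form S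

-- Every subset has a form; this is the correctness of the automaton.
form : ∀ {n} (S : Subset n) → Form S
form [] = empty (λ _ → refl) (inj₁ (refl , refl))
form (true ∷ S) with form S
... | empty none (inj₁ (s , refl)) =
  interval 0 0 (‼-cons refl none)
    (subst (IntervalShape 1 0 0) (sym (cong (push true) s)) is-whole₁)
... | empty none (inj₂ (s , p)) =
  interval 0 0 (‼-cons refl none)
    (subst (IntervalShape _ 0 0) (sym (cong (push true) s)) (is-left₁ (s≤s p)))
... | gap i j k p q si sj sk s =
  gap (suc i) (suc j) (suc k) (s≤s p) (s≤s q) si sj sk (cong (push true) s)
... | interval zero b I r = interval 0 (suc b) (‼-cons refl I) (extend-left r)
... | interval (suc a) b I r =
  gap 0 1 (suc (suc a)) (s≤s z≤n) (s≤s (s≤s z≤n)) refl (I 0)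
      (trans (I (suc a)) (within-true ≤-refl (proj₁ (shape-bounds r)))) (detached-split r)
form (false ∷ S) with form S
... | empty none (inj₁ (s , _)) = empty (‼-cons refl none) (inj₂ (cong (push false) s , s≤s z≤n))
... | empty none (inj₂ (s , _)) = empty (‼-cons refl none) (inj₂ (cong (push false) s , s≤s z≤n))
... | gap i j k p q si sj sk s =
  gap (suc i) (suc j) (suc k) (s≤s p) (s≤s q) si sj sk (cong (push false) s)
... | interval a b I r = interval (suc a) (suc b) (‼-cons refl I) (shift-absent r)

T⇒≡ : ∀ {b} → T b → b ≡ true
T⇒≡ = Equivalence.to T-≡

≡⇒T : ∀ {b} → b ≡ true → T b
≡⇒T = Equivalence.from T-≡

countBelow : ℕ → (ℕ → Bool) → ℕ
countBelow zero    Q = 0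
countBelow (suc n) Q = 𝟙 (Q 0) + countBelow n (Q ∘ suc)

count-tabulate : ∀ {X : Set} {n} (p : X → Bool) (f : Fin n → X) (Q : ℕ → Bool) →
  (∀ v → p (f v) ≡ Q (toℕ v)) → countᵇ p (List.tabulate f) ≡ countBelow n Q
count-tabulate {n = zero}  p f Q e = refl
count-tabulate {n = suc n} p f Q e =
  cong₂ _+_ (cong 𝟙 (e fzero)) (count-tabulate p (f ∘ fsuc) (Q ∘ suc) (e ∘ fsuc))

countBelow-cong : ∀ n {P Q : ℕ → Bool} → (∀ i → P i ≡ Q i) → countBelow n P ≡ countBelow n Q
countBelow-cong zero    e = refl
countBelow-cong (suc n) e = cong₂ _+_ (cong 𝟙 (e 0)) (countBelow-cong n (e ∘ suc))

countBelow-none : ∀ n → countBelow n (λ _ → false) ≡ 0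
countBelow-none zero    = refl
countBelow-none (suc n) = countBelow-none n

countBelow-disjoint : ∀ n (P Q L : ℕ → Bool) → (∀ i → P i ≡ true → Q i ≡ false) →
  countBelow n (λ i → (P i ∨ Q i) ∧ L i)
    ≡ countBelow n (λ i → P i ∧ L i) + countBelow n (λ i → Q i ∧ L i)
countBelow-disjoint zero    P Q L disjoint = refl
countBelow-disjoint (suc n) P Q L disjoint =
  trans (cong₂ _+_ (split-head (P 0) (Q 0) (L 0) (disjoint 0))
                   (countBelow-disjoint n (P ∘ suc) (Q ∘ suc) (L ∘ suc) (disjoint ∘ suc)))
        (interchange (𝟙 (P 0 ∧ L 0)) (𝟙 (Q 0 ∧ L 0))
                     (countBelow n (λ i → P (suc i) ∧ L (suc i)))
                     (countBelow n (λ i → Q (suc i) ∧ L (suc i))))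
  where
  split-head : ∀ p q l → (p ≡ true → q ≡ false) → 𝟙 ((p ∨ q) ∧ l) ≡ 𝟙 (p ∧ l) + 𝟙 (q ∧ l)
  split-head true  q l p⇒¬q rewrite p⇒¬q refl with l
  ... | true  = refl
  ... | false = refl
  split-head false q l _ = refl
  interchange : ∀ a b c d → (a + b) + (c + d) ≡ (a + c) + (b + d)
  interchange = solve-∀

countBelow-point : ∀ n y (L : ℕ → Bool) → (∀ i → n ≤ i → L i ≡ false) →
  countBelow n (λ i → (y ≡ᵇ i) ∧ L i) ≡ 𝟙 (L y)
countBelow-point zero    y       L out rewrite out y z≤n = refl
countBelow-point (suc n) zero    L out =
  trans (cong (_+_ (𝟙 (L 0))) (countBelow-none n)) (+-identityʳ _)
countBelow-point (suc n) (suc y) L out =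
  countBelow-point n y (L ∘ suc) (λ i p → out (suc i) (s≤s p))

≡ᵇ-sym : ∀ m n → (m ≡ᵇ n) ≡ (n ≡ᵇ m)
≡ᵇ-sym zero    zero    = refl
≡ᵇ-sym zero    (suc n) = refl
≡ᵇ-sym (suc m) zero    = refl
≡ᵇ-sym (suc m) (suc n) = ≡ᵇ-sym m n

previous : (ℕ → Bool) → ℕ → ℕ
previous L zero    = 0
previous L (suc y) = 𝟙 (L y)

previous≤1 : ∀ L x → previous L x ≤ 1
previous≤1 L zero    = z≤n
previous≤1 L (suc x) = 𝟙≤1 (L x)

countBelow-previous : ∀ n x (L : ℕ → Bool) → (∀ i → n ≤ i → L i ≡ false) →
  countBelow n (λ i → (suc i ≡ᵇ x) ∧ L i) ≡ previous L x
countBelow-previous n zero    L out = countBelow-none n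
countBelow-previous n (suc y) L out =
  trans (countBelow-cong n (λ i → cong (_∧ L i) (≡ᵇ-sym i y))) (countBelow-point n y L out)

neighbours : ∀ {n} (L : ℕ → Bool) → (∀ i → n ≤ i → L i ≡ false) → (v : Fin n) →
  count (λ u → pathAdj v u ∧ L (toℕ u)) ≡ 𝟙 (L (suc (toℕ v))) + previous L (toℕ v)
neighbours {n} L out v = begin
    count (λ u → pathAdj v u ∧ L (toℕ u))
  ≡⟨ count-tabulate {n = n} _ (λ u → u) (λ i → ((suc x ≡ᵇ i) ∨ (suc i ≡ᵇ x)) ∧ L i)
                    (λ _ → refl) ⟩
    countBelow n (λ i → ((suc x ≡ᵇ i) ∨ (suc i ≡ᵇ x)) ∧ L i)
  ≡⟨ countBelow-disjoint n (suc x ≡ᵇ_) (λ i → suc i ≡ᵇ x) L not-both ⟩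
    countBelow n (λ i → (suc x ≡ᵇ i) ∧ L i) + countBelow n (λ i → (suc i ≡ᵇ x) ∧ L i)
  ≡⟨ cong₂ _+_ (countBelow-point n (suc x) L out) (countBelow-previous n x L out) ⟩
    𝟙 (L (suc x)) + previous L x
  ∎
  where
  open ≡-Reasoning
  x = toℕ v
  no-2-cycle : ∀ y → (suc (suc y) ≡ᵇ y) ≡ false
  no-2-cycle zero    = refl
  no-2-cycle (suc y) = no-2-cycle y
  not-both : ∀ i → (suc x ≡ᵇ i) ≡ true → (suc i ≡ᵇ x) ≡ false
  not-both i e with ≡ᵇ⇒≡ (suc x) i (≡⇒T e)
  ... | refl = no-2-cycle x

δ-path : ∀ {n} (X : Subset n) (v : Fin n) →
  δ (PathGraph n) X v ≡ 𝟙 (X ‼ suc (toℕ v)) + previous (X ‼_) (toℕ v)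
δ-path {n} X v =
  trans (count-cong (λ u → cong (pathAdj v u ∧_) (lookup-‼ X u)) (List.allFin n))
        (neighbours (X ‼_) (‼-beyond X) v)

deg-path : ∀ {n} (v : Fin n) →
  deg (PathGraph n) v ≡ 𝟙 (less (suc (toℕ v)) n) + previous (λ i → less i n) (toℕ v)
deg-path {n} v =
  trans (count-cong (λ u → trans (sym (∧-identityʳ (pathAdj v u)))
                                 (cong (pathAdj v u ∧_) (sym (leq-true (toℕ<n u)))))
                    (List.allFin n))
        (neighbours (λ i → less i n) (λ i p → leq-false (s≤s p)) v)

max-upper : ∀ {X : Set} {n} (f : X → ℕ) (g : Fin n → X) d → (∀ v → f (g v) ≤ d) →
  List.foldr _⊔_ 0 (List.map f (List.tabulate g)) ≤ d
max-upper {n = zero}  f g d bound = z≤n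
max-upper {n = suc n} f g d bound = ⊔-lub (bound fzero) (max-upper f (g ∘ fsuc) d (bound ∘ fsuc))

max-lower : ∀ {X : Set} {n} (f : X → ℕ) (g : Fin n → X) v →
  f (g v) ≤ List.foldr _⊔_ 0 (List.map f (List.tabulate g))
max-lower f g fzero    = m≤m⊔n _ _
max-lower f g (fsuc v) = ≤-trans (max-lower f (g ∘ fsuc) v) (m≤n⊔m _ _)

pathMaxDegree : ℕ → ℕ
pathMaxDegree (suc (suc (suc k))) = 2
pathMaxDegree _                   = 1

-- δ₁(P_2) = 1, and δ₁(P_n) = 2 for n ≥ 3 (degrees are at most 2, position 1 attains it).
δ₁-path : ∀ n → 2 ≤ n → δ₁ (PathGraph n) ≡ pathMaxDegree n
δ₁-path (suc zero) (s≤s ())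
δ₁-path (suc (suc zero))    _ = refl
δ₁-path (suc (suc (suc k))) _ =
  ≤-antisym (max-upper (deg (PathGraph n)) (λ v → v) 2 deg≤2)
            (subst (_≤ δ₁ (PathGraph n)) (deg-path {n} (fsuc fzero))
                   (max-lower (deg (PathGraph n)) (λ v → v) (fsuc fzero)))
  where
  n = 3 + k
  deg≤2 : ∀ v → deg (PathGraph n) v ≤ 2
  deg≤2 v = subst (_≤ 2) (sym (deg-path v)) (+-mono-≤ (𝟙≤1 _) (previous≤1 _ (toℕ v)))

any-intro : ∀ {n} (p : Fin n → Bool) v → p v ≡ true → any p (List.allFin n) ≡ true
any-intro p v e = T⇒≡ (any⁺ p (lose (∈-allFin v) (≡⇒T e)))

any-elim : ∀ {n} (p : Fin n → Bool) → any p (List.allFin n) ≡ true →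
  Σ (Fin n) λ v → p v ≡ true
any-elim {n} p e with Any.satisfied (any⁻ p (List.allFin n) (≡⇒T e))
... | v , t = v , T⇒≡ t

allIn-intro : ∀ {n} (S : Subset n) p → (∀ v → lookup S v ≡ true → p v ≡ true) →
  allIn S p ≡ true
allIn-intro {n} S p h = T⇒≡ (all⁻ _ {List.allFin n} (All.tabulate (λ {v} _ → ≡⇒T (holds v))))
  where
  holds : ∀ v → (not (lookup S v) ∨ p v) ≡ true
  holds v with lookup S v in e
  ... | true  = h v e
  ... | false = refl

allIn-elim : ∀ {n} (S : Subset n) p → allIn S p ≡ true →
  ∀ v → lookup S v ≡ true → p v ≡ true
allIn-elim {n} S p e v vS =
  subst (λ b → (not b ∨ p v) ≡ true) vS
        (T⇒≡ (All.lookup (all⁺ _ (List.allFin n) (≡⇒T e)) (∈-allFin v)))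

∧-right : ∀ {x y} → x ∧ y ≡ true → y ≡ true
∧-right {true} e = e

adjacent-up : ∀ {n} (w v : Fin n) → suc (toℕ w) ≡ toℕ v → pathAdj w v ≡ true
adjacent-up w v e rewrite T⇒≡ (≡⇒≡ᵇ (suc (toℕ w)) (toℕ v) e) = refl

adjacent-down : ∀ {n} (w v : Fin n) → suc (toℕ v) ≡ toℕ w → pathAdj w v ≡ true
adjacent-down w v e rewrite T⇒≡ (≡⇒≡ᵇ (suc (toℕ v)) (toℕ w) e) = ∨-zeroʳ _

adjacent-cases : ∀ {n} (w v : Fin n) → pathAdj w v ≡ true →
  suc (toℕ w) ≡ toℕ v ⊎ suc (toℕ v) ≡ toℕ w
adjacent-cases w v e with suc (toℕ w) ≡ᵇ toℕ v in up
... | true  = inj₁ (≡ᵇ⇒≡ _ _ (≡⇒T up))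
... | false = inj₂ (≡ᵇ⇒≡ _ _ (≡⇒T e))

Between : ℕ → ℕ → ℕ → Set
Between x w y = (x ≤ w × w ≤ y) ⊎ (y ≤ w × w ≤ x)

between-step : ∀ {x y z w} → y ≢ z → suc w ≡ z ⊎ suc z ≡ w → Between x y z → Between x y w
between-step y≢z (inj₁ refl) (inj₁ (p , q)) = inj₁ (p , ℕ.≤-pred (≤∧≢⇒< q y≢z))
between-step y≢z (inj₁ refl) (inj₂ (p , q)) = inj₂ (≤-trans (n≤1+n _) p , q)
between-step y≢z (inj₂ refl) (inj₁ (p , q)) = inj₁ (p , ≤-trans q (n≤1+n _))
between-step y≢z (inj₂ refl) (inj₂ (p , q)) = inj₂ (≤∧≢⇒< p (y≢z ∘ sym) , q)

module Reach {n : ℕ} (S : Subset n) (u : Fin n) where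

  R : ℕ → Subset n
  R t = reach (PathGraph n) S ⁅ u ⁆ t

  step-lookup : ∀ t v → lookup (R (suc t)) v
    ≡ (lookup (R t) v ∨ (lookup S v ∧ any (λ w → lookup (R t) w ∧ pathAdj w v) (List.allFin n)))
  step-lookup t v = lookup∘tabulate _ v

  reached-start : lookup (R 0) u ≡ true
  reached-start = []=⇒lookup (x∈⁅x⁆ u)

  start-only : ∀ v → lookup (R 0) v ≡ true → v ≡ u
  start-only v e = x∈⁅y⁆⇒x≡y u (lookup⇒[]= v ⁅ u ⁆ e)

  reach-extend : ∀ t w v → lookup (R t) w ≡ true → lookup S v ≡ true → pathAdj w v ≡ true →
    lookup (R (suc t)) v ≡ true
  reach-extend t w v wR vS wv
    rewrite step-lookup t v | vS
          | any-intro (λ w → lookup (R t) w ∧ pathAdj w v) w (cong₂ _∧_ wR wv) = ∨-zeroʳ _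

  reach-mono : ∀ k t v → lookup (R t) v ≡ true → lookup (R (k + t)) v ≡ true
  reach-mono zero    t v e = e
  reach-mono (suc k) t v e rewrite step-lookup (k + t) v | reach-mono k t v e = refl

  reach-within-n : ∀ d → d ≤ n → ∀ v → lookup (R d) v ≡ true → lookup (R n) v ≡ true
  reach-within-n d d≤n v e =
    subst (λ t → lookup (R t) v ≡ true) (m∸n+n≡m d≤n) (reach-mono (n ∸ d) d v e)

  Spanned : Fin n → Set
  Spanned v = ∀ w → Between (toℕ u) w (toℕ v) → S ‼ w ≡ true

  spanned-step : ∀ w v → Spanned w → lookup S v ≡ true → pathAdj w v ≡ true → Spanned v
  spanned-step w v span vS wv y between with y ℕ.≟ toℕ v
  ... | yes refl = trans (sym (lookup-‼ S v)) vS
  ... | no  y≢v  = span y (between-step y≢v (adjacent-cases w v wv) between)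

  reach-sound : lookup S u ≡ true → ∀ t v → lookup (R t) v ≡ true → Spanned v
  reach-sound uS zero v e with start-only v e
  ... | refl = λ w between → subst (λ x → S ‼ x ≡ true) (sym (collapse between))
                                   (trans (sym (lookup-‼ S u)) uS)
    where
    collapse : ∀ {w} → Between (toℕ u) w (toℕ u) → w ≡ toℕ u
    collapse (inj₁ (p , q)) = ≤-antisym q p
    collapse (inj₂ (p , q)) = ≤-antisym q p
  reach-sound uS (suc t) v e rewrite step-lookup t v with lookup (R t) v in vR
  ... | true  = reach-sound uS t v vR
  ... | false with lookup S v in vS
  ...   | true with any-elim (λ w → lookup (R t) w ∧ pathAdj w v) e
  ...     | w , wRv with lookup (R t) w in wR
  ...       | true = spanned-step w v (reach-sound uS t w wR) vS wRv

  module _ {a b : ℕ} (I : IsInterval S a b) (a≤u : a ≤ toℕ u) (u≤b : toℕ u ≤ b) where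

    reach-up : ∀ d (v : Fin n) → toℕ v ≡ toℕ u + d → toℕ v ≤ b → lookup (R d) v ≡ true
    reach-up zero v e _ rewrite toℕ-injective (trans e (+-identityʳ _)) = reached-start
    reach-up (suc d) v e v≤b =
      reach-extend d w v (reach-up d w w-at w≤b)
        (interval-member {S = S} {a} {b} I v
                         (≤-trans a≤u (subst (toℕ u ≤_) (sym e) (m≤m+n _ _))) v≤b)
        (adjacent-up w v (trans (cong suc w-at) (sym v-at)))
      where
      v-at : toℕ v ≡ suc (toℕ u + d)
      v-at = trans e (+-suc (toℕ u) d)
      w<n : toℕ u + d < n
      w<n = <-trans (n<1+n _) (subst (_< n) v-at (toℕ<n v))
      w : Fin n
      w = fromℕ< w<n
      w-at : toℕ w ≡ toℕ u + d
      w-at = toℕ-fromℕ< w<n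
      w≤b : toℕ w ≤ b
      w≤b = subst (_≤ b) (sym w-at) (≤-trans (n≤1+n _) (subst (_≤ b) v-at v≤b))

    reach-down : ∀ d (v : Fin n) → toℕ v + d ≡ toℕ u → a ≤ toℕ v → lookup (R d) v ≡ true
    reach-down zero v e _ rewrite toℕ-injective (trans (sym (+-identityʳ _)) e) = reached-start
    reach-down (suc d) v e a≤v =
      reach-extend d w v (reach-down d w w+d a≤w)
        (interval-member {S = S} {a} {b} I v a≤v
                         (≤-trans (m≤m+n _ (suc d)) (subst (_≤ b) (sym e) u≤b)))
        (adjacent-down w v (sym w-at))
      where
      v+1+d : suc (toℕ v) + d ≡ toℕ u
      v+1+d = trans (sym (+-suc (toℕ v) d)) e
      w<n : suc (toℕ v) < n
      w<n = <-≤-trans (s≤s (subst (suc (toℕ v) ≤_) v+1+d (m≤m+n _ d))) (toℕ<n u)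
      w : Fin n
      w = fromℕ< w<n
      w-at : toℕ w ≡ suc (toℕ v)
      w-at = toℕ-fromℕ< w<n
      w+d : toℕ w + d ≡ toℕ u
      w+d = trans (cong (_+ d) w-at) v+1+d
      a≤w : a ≤ toℕ w
      a≤w = ≤-trans a≤v (subst (toℕ v ≤_) (sym w-at) (n≤1+n _))

    reach-interval : ∀ (v : Fin n) → a ≤ toℕ v → toℕ v ≤ b → lookup (R n) v ≡ true
    reach-interval v a≤v v≤b with ≤-total (toℕ u) (toℕ v)
    ... | inj₁ u≤v = reach-within-n _ (≤-trans (m∸n≤m (toℕ v) (toℕ u)) (<⇒≤ (toℕ<n v))) v
                       (reach-up _ v (sym (m+[n∸m]≡n u≤v)) v≤b)
    ... | inj₂ v≤u = reach-within-n _ (≤-trans (m∸n≤m (toℕ u) (toℕ v)) (<⇒≤ (toℕ<n u))) v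
                       (reach-down _ v (m+[n∸m]≡n v≤u) a≤v)

connected-interval : ∀ {n} (S : Subset n) {a b} → IsInterval S a b → a ≤ b → b < n →
  connected (PathGraph n) S ≡ true
connected-interval {n} S {a} {b} I a≤b b<n =
  cong₂ _∧_ (any-intro (lookup S) v₀ (interval-member {S = S} {a} {b} I v₀ a≤v₀ v₀≤b))
            (allIn-intro S _ λ u uS → allIn-intro S _ λ v vS →
               Reach.reach-interval S u {a} {b} I (lower u uS) (upper u uS)
                                    v (lower v vS) (upper v vS))
  where
  lower : ∀ v → lookup S v ≡ true → a ≤ toℕ v
  lower v vS = proj₁ (interval-bounds {S = S} {a} {b} I v vS)
  upper : ∀ v → lookup S v ≡ true → toℕ v ≤ b
  upper v vS = proj₂ (interval-bounds {S = S} {a} {b} I v vS)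
  a<n = <-≤-trans (s≤s a≤b) b<n
  v₀  = fromℕ< a<n
  a≤v₀ = subst (a ≤_) (sym (toℕ-fromℕ< a<n)) ≤-refl
  v₀≤b = subst (_≤ b) (sym (toℕ-fromℕ< a<n)) a≤b

-- The empty set is not connected (the definition requires nonemptiness).
disconnected-empty : ∀ {n} (S : Subset n) → (∀ i → S ‼ i ≡ false) →
  connected (PathGraph n) S ≡ false
disconnected-empty S none with nonempty S in ne
... | false = refl
... | true with any-elim (lookup S) ne
...   | v , vS with trans (sym vS) (trans (lookup-‼ S v) (none (toℕ v)))
...     | ()

-- A set with a gap is not connected: a walk in ⟨S⟩ from i to k would pass through j.
disconnected-gap : ∀ {n} (S : Subset n) i j k → i < j → j < k →
  S ‼ i ≡ true → S ‼ j ≡ false → S ‼ k ≡ true → connected (PathGraph n) S ≡ false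
disconnected-gap {n} S i j k i<j j<k si sj sk with connected (PathGraph n) S in conn
... | false = refl
... | true with trans (sym sj) (Reach.reach-sound S u uS n v reach-uv j (inj₁ (i≤j , j≤k)))
  where
  vertex : ∀ x → S ‼ x ≡ true → Σ (Fin n) λ w → toℕ w ≡ x × lookup S w ≡ true
  vertex x sx = w , at , trans (lookup-‼ S w) (subst (λ y → S ‼ y ≡ true) (sym at) sx)
    where
    w  = fromℕ< (‼-bound S x sx)
    at = toℕ-fromℕ< (‼-bound S x sx)
  u   = proj₁ (vertex i si)
  v   = proj₁ (vertex k sk)
  uS  = proj₂ (proj₂ (vertex i si))
  vS  = proj₂ (proj₂ (vertex k sk))
  i≤j = subst (_≤ j) (sym (proj₁ (proj₂ (vertex i si)))) (<⇒≤ i<j)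
  j≤k = subst (j ≤_) (sym (proj₁ (proj₂ (vertex k sk)))) (<⇒≤ j<k)
  reach-uv = allIn-elim S _ (allIn-elim S _ (∧-right conn) u uS) v vS
... | ()

+-cancelˡ-≤ᶻ : ∀ d {k m : ℤ} → d ℤ.+ k ℤ.≤ d ℤ.+ m → k ℤ.≤ m
+-cancelˡ-≤ᶻ d {k} {m} p = subst₂ ℤ._≤_ (cancel k) (cancel m) (ℤP.+-monoʳ-≤ (ℤ.- d) p)
  where
  cancel : ∀ x → ℤ.- d ℤ.+ (d ℤ.+ x) ≡ x
  cancel x = trans (sym (ℤP.+-assoc (ℤ.- d) d x))
                   (trans (cong (ℤ._+ x) (ℤP.+-inverseˡ d)) (ℤP.+-identityˡ x))

alliance-threshold : ∀ {n} (G : Graph n) (S : Subset n) (m : ℤ) →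
  (∀ v → lookup S v ≡ true → + δ G (∁ S) v ℤ.+ m ℤ.≤ + δ G S v) →
  (v₀ : Fin n) → lookup S v₀ ≡ true → + δ G (∁ S) v₀ ℤ.+ m ≡ + δ G S v₀ →
  ∀ k → isDefAlliance G S k ≡ (k ℤ.≤ᵇ m)
alliance-threshold G S m margin v₀ v₀S tight k = ⇔→≡ {z = true} (mk⇔ only-below all-below)
  where
  only-below : isDefAlliance G S k ≡ true → (k ℤ.≤ᵇ m) ≡ true
  only-below e = T⇒≡ (ℤP.≤⇒≤ᵇ {k} {m} (+-cancelˡ-≤ᶻ (+ δ G (∁ S) v₀)
                   (subst (+ δ G (∁ S) v₀ ℤ.+ k ℤ.≤_) (sym tight)
                          (ℤP.≤ᵇ⇒≤ {+ δ G (∁ S) v₀ ℤ.+ k} (≡⇒T (allIn-elim S _ e v₀ v₀S))))))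
  all-below : (k ℤ.≤ᵇ m) ≡ true → isDefAlliance G S k ≡ true
  all-below e = allIn-intro S _ λ v vS →
    T⇒≡ (ℤP.≤⇒≤ᵇ {+ δ G (∁ S) v ℤ.+ k}
           (ℤP.≤-trans (ℤP.+-monoʳ-≤ (+ δ G (∁ S) v) (ℤP.≤ᵇ⇒≤ {k} {m} (≡⇒T e))) (margin v vS)))

filterᵇ-cong : ∀ {X : Set} {p q : X → Bool} → (∀ x → p x ≡ q x) → ∀ xs →
  filterᵇ p xs ≡ filterᵇ q xs
filterᵇ-cong e []       = refl
filterᵇ-cong e (x ∷ xs) rewrite e x | filterᵇ-cong e xs = refl

largestBelow : ℕ → ℤ → ℤ
largestBelow d m = List.foldr ℤ._⊔_ (ℤ.- (+ d))
  (filterᵇ (ℤ._≤ᵇ m) (List.map (λ i → ℤ.- (+ d) ℤ.+ + i) (List.upTo (suc (2 * d)))))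

exactIndex-threshold : ∀ {n} (G : Graph n) (S : Subset n) m →
  (∀ k → isDefAlliance G S k ≡ (k ℤ.≤ᵇ m)) → exactIndex G S ≡ largestBelow (δ₁ G) m
exactIndex-threshold G S m threshold =
  cong (List.foldr ℤ._⊔_ (ℤ.- (+ δ₁ G))) (filterᵇ-cong threshold (𝒦 G))

-- The least margins that occur in P_n; −2 needs an interior vertex, hence n ≥ 3.
data Margin (n : ℕ) : ℤ → Set where
  margin+1 : Margin n (+ 1)
  margin0  : Margin n (+ 0)
  margin-1 : Margin n -[1+ 0 ]
  margin-2 : 3 ≤ n → Margin n -[1+ 1 ]

-- Each such margin lies in 𝒦 = [−δ₁, δ₁], so it is the largest admissible index
-- (a finite computation for the two possible values of δ₁).
largestBelow-margin : ∀ n → 2 ≤ n → ∀ {m} → Margin n m → largestBelow (pathMaxDegree n) m ≡ m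
largestBelow-margin (suc zero) (s≤s ())
largestBelow-margin (suc (suc zero)) _ margin+1 = refl
largestBelow-margin (suc (suc zero)) _ margin0  = refl
largestBelow-margin (suc (suc zero)) _ margin-1 = refl
largestBelow-margin (suc (suc zero)) _ (margin-2 (s≤s (s≤s ())))
largestBelow-margin (suc (suc (suc k))) _ margin+1     = refl
largestBelow-margin (suc (suc (suc k))) _ margin0      = refl
largestBelow-margin (suc (suc (suc k))) _ margin-1     = refl
largestBelow-margin (suc (suc (suc k))) _ (margin-2 _) = refl

exactIndex-path : ∀ {n} (S : Subset n) {m} → 2 ≤ n → Margin n m →
  (∀ v → lookup S v ≡ true → + δ (PathGraph n) (∁ S) v ℤ.+ m ℤ.≤ + δ (PathGraph n) S v) →
  (v₀ : Fin n) → lookup S v₀ ≡ true →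
  + δ (PathGraph n) (∁ S) v₀ ℤ.+ m ≡ + δ (PathGraph n) S v₀ →
  exactIndex (PathGraph n) S ≡ m
exactIndex-path {n} S {m} 2≤n μ margin v₀ v₀S tight = begin
    exactIndex (PathGraph n) S
  ≡⟨ exactIndex-threshold (PathGraph n) S m
       (alliance-threshold (PathGraph n) S m margin v₀ v₀S tight) ⟩
    largestBelow (δ₁ (PathGraph n)) m
  ≡⟨ cong (λ d → largestBelow d m) (δ₁-path n 2≤n) ⟩
    largestBelow (pathMaxDegree n) m
  ≡⟨ largestBelow-margin n 2≤n μ ⟩
    m
  ∎
  where open ≡-Reasoning

insideDegree : ℕ → ℕ → ℕ → ℕ
insideDegree a b x = 𝟙 (less x b) + 𝟙 (less a x)

outsideDegree : ℕ → ℕ → ℕ → ℕ → ℕ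
outsideDegree n a b x = 𝟙 (less (suc x) n ∧ not (less x b)) + 𝟙 (less 0 x ∧ not (less a x))

module IntervalDegrees {n : ℕ} (S : Subset n) {a b : ℕ} (I : IsInterval S a b) (b<n : b < n) where

  δ-inside : ∀ (v : Fin n) → a ≤ toℕ v → toℕ v ≤ b →
    δ (PathGraph n) S v ≡ insideDegree a b (toℕ v)
  δ-inside v a≤v v≤b
    rewrite δ-path S v | I (suc (toℕ v)) | leq-true (≤-trans a≤v (n≤1+n (toℕ v))) =
    cong (_+_ (𝟙 (less (toℕ v) b))) (below (toℕ v) v≤b)
    where
    below : ∀ x → x ≤ b → previous (S ‼_) x ≡ 𝟙 (less a x)
    below zero    _   = refl
    below (suc y) y<b rewrite I y | leq-true (≤-trans (n≤1+n y) y<b) | ∧-identityʳ (leq a y) = refl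

  δ-outside : ∀ (v : Fin n) → a ≤ toℕ v → toℕ v ≤ b →
    δ (PathGraph n) (∁ S) v ≡ outsideDegree n a b (toℕ v)
  δ-outside v a≤v v≤b rewrite δ-path (∁ S) v =
    cong₂ _+_ (above (toℕ v) a≤v) (below (toℕ v) v≤b)
    where
    above : ∀ x → a ≤ x → 𝟙 (∁ S ‼ suc x) ≡ 𝟙 (less (suc x) n ∧ not (less x b))
    above x a≤x with suc x ℕ.<? n
    ... | no  x+1≮n rewrite ‼-beyond (∁ S) (suc x) (≮⇒≥ x+1≮n) | leq-false (s≤s (≮⇒≥ x+1≮n)) = refl
    ... | yes x+1<n rewrite ‼-∁ S (suc x) x+1<n | I (suc x) | leq-true (≤-trans a≤x (n≤1+n x))
                          | leq-true x+1<n = refl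
    below : ∀ x → x ≤ b → previous (∁ S ‼_) x ≡ 𝟙 (less 0 x ∧ not (less a x))
    below zero    _   = refl
    below (suc y) y<b rewrite ‼-∁ S y (<-trans y<b b<n) | I y | leq-true (≤-trans (n≤1+n y) y<b)
                            | ∧-identityʳ (leq a y) = refl

exactIndex-interval : ∀ {n} (S : Subset n) {a b m} → IsInterval S a b → b < n → 2 ≤ n →
  Margin n m →
  (∀ x → a ≤ x → x ≤ b → + outsideDegree n a b x ℤ.+ m ℤ.≤ + insideDegree a b x) →
  ∀ x₀ → a ≤ x₀ → x₀ ≤ b → + outsideDegree n a b x₀ ℤ.+ m ≡ + insideDegree a b x₀ →
  exactIndex (PathGraph n) S ≡ m
exactIndex-interval {n} S {a} {b} {m} I b<n 2≤n μ margin x₀ a≤x₀ x₀≤b tight =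
  exactIndex-path S 2≤n μ margin-at v₀ (interval-member {S = S} {a} {b} I v₀ a≤v₀ v₀≤b)
    (subst₂ (λ o i → + o ℤ.+ m ≡ + i) (sym (δ-outside v₀ a≤v₀ v₀≤b)) (sym (δ-inside v₀ a≤v₀ v₀≤b))
            (subst (λ x → + outsideDegree n a b x ℤ.+ m ≡ + insideDegree a b x) (sym at) tight))
  where
  open IntervalDegrees S {a} {b} I b<n
  x₀<n = ≤-<-trans x₀≤b b<n
  v₀   = fromℕ< x₀<n
  at   = toℕ-fromℕ< x₀<n
  a≤v₀ = subst (a ≤_) (sym at) a≤x₀
  v₀≤b = subst (_≤ b) (sym at) x₀≤b
  margin-at : ∀ v → lookup S v ≡ true →
    + δ (PathGraph n) (∁ S) v ℤ.+ m ℤ.≤ + δ (PathGraph n) S v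
  margin-at v vS with interval-bounds {S = S} {a} {b} I v vS
  ... | a≤v , v≤b rewrite δ-outside v a≤v v≤b | δ-inside v a≤v v≤b = margin (toℕ v) a≤v v≤b

-- The whole path: every vertex has no outside neighbour and at least one inside, and
-- the end vertex 0 has exactly one; so k_S = 1.
index-whole : ∀ {k} (S : Subset (2 + k)) → IsInterval S 0 (1 + k) →
  exactIndex (PathGraph (2 + k)) S ≡ + 1
index-whole {k} S I =
  exactIndex-interval S I ≤-refl (s≤s (s≤s z≤n)) margin+1 margin 0 z≤n z≤n refl
  where
  margin : ∀ x → 0 ≤ x → x ≤ 1 + k →
    + outsideDegree (2 + k) 0 (1 + k) x ℤ.+ + 1 ℤ.≤ + insideDegree 0 (1 + k) x
  margin zero    _ _ = ℤ.+≤+ ≤-refl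
  margin (suc x) _ _ rewrite ∧-inverseʳ (leq (suc x) k) = ℤ.+≤+ (m≤n+m 1 _)

-- If a vertex has an inside neighbour in at least one direction, its outside neighbours
-- are at most its inside neighbours: outside neighbours only lie in the other directions.
outside≤inside : ∀ A B P Q → A ≡ true ⊎ B ≡ true →
  𝟙 (P ∧ not A) + 𝟙 (Q ∧ not B) ≤ 𝟙 A + 𝟙 B
outside≤inside true  true  P Q _ rewrite ∧-zeroʳ P | ∧-zeroʳ Q = z≤n
outside≤inside true  false P Q _ rewrite ∧-zeroʳ P | ∧-identityʳ Q = 𝟙≤1 Q
outside≤inside false true  P Q _ rewrite ∧-identityʳ P | ∧-zeroʳ Q =
  ≤-trans (≤-reflexive (+-identityʳ _)) (𝟙≤1 P)
outside≤inside false false P Q (inj₁ ())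
outside≤inside false false P Q (inj₂ ())

long-margin : ∀ n {a b} → a < b → ∀ x → a ≤ x → x ≤ b →
  + outsideDegree n a b x ℤ.+ + 0 ℤ.≤ + insideDegree a b x
long-margin n {a} {b} a<b x _ x≤b =
  ℤ.+≤+ (≤-trans (≤-reflexive (+-identityʳ _))
                 (outside≤inside (less x b) (less a x) (less (suc x) n) (less 0 x)
                                 inside-neighbour))
  where
  inside-neighbour : less x b ≡ true ⊎ less a x ≡ true
  inside-neighbour with x ℕ.≟ b
  ... | yes refl = inj₂ (leq-true a<b)
  ... | no  x≢b  = inj₁ (leq-true (≤∧≢⇒< x≤b x≢b))

-- An interval with at least two vertices that misses an end of the path: its end vertex
-- next to the missing part has one neighbour on each side, so k_S = 0.
index-long : ∀ {n} (S : Subset n) {a b} → IsInterval S a b → a < b → b < n → 2 ≤ n →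
  1 ≤ a ⊎ suc b < n → exactIndex (PathGraph n) S ≡ + 0
index-long {n} S {a} {b} I a<b b<n 2≤n (inj₁ 1≤a) =
  exactIndex-interval S I b<n 2≤n margin0 (long-margin n a<b) a ≤-refl (<⇒≤ a<b) tight
  where
  tight : + outsideDegree n a b a ℤ.+ + 0 ≡ + insideDegree a b a
  tight rewrite leq-true a<b | less-irrefl a | ∧-zeroʳ (less (suc a) n) | leq-true 1≤a = refl
index-long {n} S {a} {b} I a<b b<n 2≤n (inj₂ b+1<n) =
  exactIndex-interval S I b<n 2≤n margin0 (long-margin n a<b) b (<⇒≤ a<b) ≤-refl tight
  where
  tight : + outsideDegree n a b b ℤ.+ + 0 ≡ + insideDegree a b b
  tight rewrite leq-true a<b | less-irrefl b | leq-true b+1<n | ∧-zeroʳ (less 0 b) = refl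

-- A single vertex: its exact index is minus its degree.
index-single : ∀ {n} (S : Subset n) {a m} → IsInterval S a a → a < n → 2 ≤ n → Margin n m →
  + (𝟙 (less (suc a) n) + 𝟙 (less 0 a)) ℤ.+ m ≡ + 0 → exactIndex (PathGraph n) S ≡ m
index-single {n} S {a} {m} I a<n 2≤n μ minus-degree =
  exactIndex-interval S I a<n 2≤n μ margin a ≤-refl ≤-refl tight
  where
  tight : + outsideDegree n a a a ℤ.+ m ≡ + insideDegree a a a
  tight rewrite less-irrefl a | ∧-identityʳ (less (suc a) n) | ∧-identityʳ (less 0 a) =
    minus-degree
  margin : ∀ x → a ≤ x → x ≤ a → + outsideDegree n a a x ℤ.+ m ℤ.≤ + insideDegree a a x
  margin x a≤x x≤a rewrite ≤-antisym x≤a a≤x = ℤP.≤-reflexive tight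

offset : Shape → ℤ
offset whole  = + 1
offset left₁  = -[1+ 0 ]
offset right₁ = -[1+ 0 ]
offset inner₁ = -[1+ 1 ]
offset _      = + 0

index-by-shape : ∀ {n a b c} (S : Subset n) → IsInterval S a b → IntervalShape n a b c →
  2 ≤ n → exactIndex (PathGraph n) S ≡ offset c
index-by-shape S I is-whole₁ (s≤s ())
index-by-shape S I is-whole _ = index-whole S I
index-by-shape S I (is-left₁ 1<n) 2≤n =
  index-single S I (<-trans (s≤s z≤n) 1<n) 2≤n margin-1
    (cong (λ t → + (𝟙 t + 0) ℤ.+ -[1+ 0 ]) (leq-true 1<n))
index-by-shape S I (is-left 1≤b b+1<n) 2≤n =
  index-long S I 1≤b (<-trans (n<1+n _) b+1<n) 2≤n (inj₂ b+1<n)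
index-by-shape {suc (suc a)} S I is-right₁ 2≤n =
  index-single S I ≤-refl 2≤n margin-1
    (cong (λ t → + (𝟙 t + 1) ℤ.+ -[1+ 0 ]) (less-irrefl (suc (suc a))))
index-by-shape S I (is-right 1≤a a<b) 2≤n = index-long S I a<b ≤-refl 2≤n (inj₁ 1≤a)
index-by-shape S I (is-inner₁ 1≤a a+1<n) 2≤n =
  index-single S I (<-trans (n<1+n _) a+1<n) 2≤n (margin-2 (≤-trans (s≤s (s≤s 1≤a)) a+1<n))
    (cong₂ (λ s t → + (𝟙 s + 𝟙 t) ℤ.+ -[1+ 1 ]) (leq-true a+1<n) (leq-true 1≤a))
index-by-shape S I (is-inner 1≤a a<b b+1<n) 2≤n =
  index-long S I a<b (<-trans (n<1+n _) b+1<n) 2≤n (inj₁ 1≤a)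

isConnected : Shape → Bool
isConnected start = false
isConnected zeros = false
isConnected split = false
isConnected _     = true

shape-connected : ∀ {n a b c} → IntervalShape n a b c → isConnected c ≡ true
shape-connected is-whole₁        = refl
shape-connected is-whole         = refl
shape-connected (is-left₁ _)     = refl
shape-connected (is-left _ _)    = refl
shape-connected is-right₁        = refl
shape-connected (is-right _ _)   = refl
shape-connected (is-inner₁ _ _)  = refl
shape-connected (is-inner _ _ _) = refl

contributes : ℕ → ℤ → Shape → Bool
contributes n j c = isConnected c ∧ does ((+ n ℤ.+ offset c) ℤ.≟ j)

summand-by-shape : ∀ n → 2 ≤ n → ∀ j (S : Subset n) →
  (connected (PathGraph n) S ∧ does ((+ n ℤ.+ exactIndex (PathGraph n) S) ℤ.≟ j))
    ≡ contributes n j (shapeOf S)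
summand-by-shape n 2≤n j S with form S
... | empty none (inj₁ (s , _)) rewrite disconnected-empty S none | s = refl
... | empty none (inj₂ (s , _)) rewrite disconnected-empty S none | s = refl
... | gap i k l i<k k<l si sk sl s rewrite disconnected-gap S i k l i<k k<l si sk sl | s = refl
... | interval a b I r
  rewrite connected-interval S I (proj₁ (shape-bounds r)) (proj₂ (shape-bounds r))
        | shape-connected r | index-by-shape S I r 2≤n = refl

A-by-shape : ∀ n → 2 ≤ n → ∀ j → A (PathGraph n) j ≡ weigh (census n) (contributes n j)
A-by-shape n 2≤n j =
  trans (count-cong (summand-by-shape n 2≤n j) (subsets n)) (count-by-shape n (contributes n j))

collect : ∀ m (h : Shape → Bool) {e₀ e₁ e₂ e₃} →
  h start ≡ false → h zeros ≡ false → h split ≡ false →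
  h inner₁ ≡ e₀ → h left₁ ≡ e₁ → h right₁ ≡ e₁ → h left ≡ e₂ → h right ≡ e₂ → h inner ≡ e₂ →
  h whole ≡ e₃ →
  weigh (census₂ m) h ≡ m * 𝟙 e₀ + 2 * 𝟙 e₁ + (m + m + triangle m) * 𝟙 e₂ + 1 * 𝟙 e₃
collect m h {e₀} {e₁} {e₂} {e₃} hs hz hx hi₁ hl₁ hr₁ hl hr hi hw
  rewrite hs | hz | hx | hi₁ | hl₁ | hr₁ | hl | hr | hi | hw =
  regroup (𝟙 (h whole₁)) m (triangle m) (𝟙 e₀) (𝟙 e₁) (𝟙 e₂) (𝟙 e₃)
  where
  regroup : ∀ w₁ m t d₀ d₁ d₂ d₃ →
    0 + 0 + w₁ * 0 + d₃ * 1 + d₁ * 1 + d₂ * m + d₁ * 1 + d₂ * m + d₀ * m + d₂ * t + 0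
      ≡ m * d₀ + 2 * d₁ + (m + m + t) * d₂ + 1 * d₃
  regroup = solve-∀

monomial-at : ∀ c e j → monomial c (+ e) j ≡ c * 𝟙 (does (+ e ℤ.≟ j))
monomial-at c e j with j ℤ.≟ + e | + e ℤ.≟ j
... | yes _   | yes _   = sym (*-identityʳ c)
... | no  _   | no  _   = sym (*-zeroʳ c)
... | yes j≡e | no  e≢j = ⊥-elim (e≢j (sym j≡e))
... | no  j≢e | yes e≡j = ⊥-elim (j≢e (sym e≡j))

-- 2 · triangle m + m = m², used to clear the division by 2 in the middle coefficient.
triangle-double : ∀ m → triangle m + triangle m + m ≡ m * m
triangle-double zero    = refl
triangle-double (suc m) = begin
    (m + triangle m) + (m + triangle m) + suc m
  ≡⟨ rearrange m (triangle m) ⟩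
    (triangle m + triangle m + m) + (m + m + 1)
  ≡⟨ cong (_+ (m + m + 1)) (triangle-double m) ⟩
    m * m + (m + m + 1)
  ≡⟨ square-step m ⟩
    suc m * suc m
  ∎
  where
  open ≡-Reasoning
  rearrange : ∀ m t → (m + t) + (m + t) + suc m ≡ (t + t + m) + (m + m + 1)
  rearrange = solve-∀
  square-step : ∀ m → m * m + (m + m + 1) ≡ suc m * suc m
  square-step = solve-∀

-- (n − 2)(n + 1)/2 = 2(n − 2) + (n − 2)(n − 3)/2: the intervals of length ≥ 2 other than
-- the whole path, counted by the states left, right and inner.
middle-coefficient : ∀ m → (m * (3 + m)) / 2 ≡ m + m + triangle m
middle-coefficient m = trans (cong (_/ 2) doubled) (m*n/n≡m (m + m + triangle m) 2)
  where
  open ≡-Reasoning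
  expand : ∀ m → m * (3 + m) ≡ m + m + m + m * m
  expand = solve-∀
  collect-terms : ∀ m t → m + m + m + (t + t + m) ≡ (m + m + t) * 2
  collect-terms = solve-∀
  doubled : m * (3 + m) ≡ (m + m + triangle m) * 2
  doubled = begin
      m * (3 + m)
    ≡⟨ expand m ⟩
      m + m + m + m * m
    ≡⟨ cong (_+_ (m + m + m)) (sym (triangle-double m)) ⟩
      m + m + m + (triangle m + triangle m + m)
    ≡⟨ collect-terms m (triangle m) ⟩
      (m + m + triangle m) * 2
    ∎

proposition3p1 : (n : ℕ) → n ≥ 2 →
    ∀ j → A (PathGraph n) j ≡
      (monomial (n ∸ 2) (+ (n ∸ 2)) ⊕ monomial 2 (+ (n ∸ 1))
        ⊕ monomial (((n ∸ 2) * suc n) / 2) (+ n) ⊕ monomial 1 (+ suc n)) j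
proposition3p1 (suc zero) (s≤s ()) j
proposition3p1 (suc (suc m)) 2≤n j = begin
    A (PathGraph (2 + m)) j
  ≡⟨ A-by-shape (2 + m) 2≤n j ⟩
    weigh (census (2 + m)) (contributes (2 + m) j)
  ≡⟨ weigh-cong (census-closed m) (contributes (2 + m) j) ⟩
    weigh (census₂ m) (contributes (2 + m) j)
  ≡⟨ collect m (contributes (2 + m) j) refl refl refl refl refl refl
       (same-exponent (+-identityʳ (2 + m))) (same-exponent (+-identityʳ (2 + m)))
       (same-exponent (+-identityʳ (2 + m))) (same-exponent (+-comm (2 + m) 1)) ⟩
    m * hit m + 2 * hit (1 + m) + (m + m + triangle m) * hit (2 + m) + 1 * hit (3 + m)
  ≡⟨ sym (cong₂ _+_ (cong₂ _+_ (cong₂ _+_ (monomial-at m m j) (monomial-at 2 (1 + m) j))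
                               (trans (monomial-at _ (2 + m) j)
                                      (cong (_* hit (2 + m)) (middle-coefficient m))))
                    (monomial-at 1 (3 + m) j)) ⟩
    (monomial m (+ m) ⊕ monomial 2 (+ (1 + m))
      ⊕ monomial ((m * (3 + m)) / 2) (+ (2 + m)) ⊕ monomial 1 (+ (3 + m))) j
  ∎
  where
  open ≡-Reasoning
  hit : ℕ → ℕ
  hit e = 𝟙 (does (+ e ℤ.≟ j))
  same-exponent : ∀ {e e′} → e ≡ e′ → does (+ e ℤ.≟ j) ≡ does (+ e′ ℤ.≟ j)
  same-exponent refl = refl
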